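{- Two canonical weighted trees $T$ and $T'$ are isomorphic if and only if their centroid-rooted trees $\vec T$ and $\vec{T'}$ are isomorphic and both are canonical.
   Context: A weighted tree is a pair $(T,w)$ with $T$ a finite tree and $w$ a non-negative integer vertex weight function with at least one positive value. It is canonical if its zero-weight vertices form an independent set and every leaf has positive weight; a directed (rooted) weighted tree is canonical if its underlying weighted tree is canonical. The subtrees of $v$ are the components of $T-v$; $\mathrm{hs}(v)$ is the maximum weight of a subtree of $v$ ($0$ if $T$ has one vertex); a centroid is a vertex minimizing $\mathrm{hs}$; the centroids form the vertex set of a path, and a centroid is central if it is a center of this path. Fix a total order $\prec$ on weighted rooted trees. The centroid-rooted tree $\vec T$ is obtained by designating a root $r$: if there is exactly one central centroid $c$, $r=c$; otherwise, with central centroids $c_1,c_2$ and $T_1,T_2$ the rooted subtrees obtained by removing edge $c_1c_2$ ($c_i$ the root of $T_i$), $r$ is arbitrary among $c_1,c_2$ if $T_1\cong T_2$, and otherwise $r=c_1$ if $T_1\prec T_2$ and $r=c_2$ else. Isomorphisms of weighted (rooted) trees are bijections preserving (directed) adjacency and weights. -}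

module Defs where

open import Data.Nat using (ℕ; zero; suc; _≤_; _<_; _+_)
open import Data.Fin using (Fin)
open import Data.Bool using (Bool; true; false; if_then_else_)
open import Data.List using (List; []; _∷_; _∷ʳ_; length; map; filterᵇ; allFin)
open import Data.Nat.ListAction using (sum)
open import Data.List.Relation.Unary.Linked using (Linked)
open import Data.List.Relation.Unary.Unique.Propositional using (Unique)
open import Data.Product using (Σ; Σ-syntax; ∃; _×_; _,_)
open import Data.Sum using (_⊎_)
open import Data.Empty using (⊥)
open import Relation.Nullary using (¬_)
open import Relation.Binary.PropositionalEquality using (_≡_; _≢_)
open import Function.Bundles using (_⤖_; _⇔_; Bijection)

data Walk {A : Set} (E : A → A → Set) : A → A → ℕ → Set where
  here : (x : A) → Walk E x x zero
  step : {x y z : A} {k : ℕ} → E x y → Walk E y z k → Walk E x z (suc k)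

Reach : {A : Set} → (A → A → Set) → A → A → Set
Reach E x y = Σ ℕ (λ k → Walk E x y k)

record WGraph : Set where
  field
    n   : ℕ
    adj : Fin n → Fin n → Bool
    w   : Fin n → ℕ

open WGraph public

Adj : (G : WGraph) → Fin (n G) → Fin (n G) → Set
Adj G x y = adj G x y ≡ true

-- a cycle: distinct vertices x ∷ ys, at least 3 of them, consecutive ones
-- adjacent and the last adjacent to x
HasCycle : WGraph → Set
HasCycle G = Σ (Fin (n G)) λ x → Σ (List (Fin (n G))) λ ys →
  (2 ≤ length ys) × Unique (x ∷ ys) × Linked (Adj G) ((x ∷ ys) ∷ʳ x)

record IsWTree (G : WGraph) : Set where
  field
    nonempty  : 1 ≤ n G
    symmetric : ∀ x y → adj G x y ≡ adj G y x
    irrefl    : ∀ x → adj G x x ≡ false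
    connected : ∀ x y → Reach (Adj G) x y
    acyclic   : ¬ HasCycle G
    positive  : Σ (Fin (n G)) λ x → 1 ≤ w G x

degree : (G : WGraph) → Fin (n G) → ℕ
degree G x = length (filterᵇ (adj G x) (allFin (n G)))

IsLeaf : (G : WGraph) → Fin (n G) → Set
IsLeaf G x = degree G x ≡ 1

Canonical : WGraph → Set
Canonical G =
  (∀ x y → Adj G x y → w G x ≡ 0 → w G y ≡ 0 → ⊥) ×
  (∀ x → IsLeaf G x → 1 ≤ w G x)

_≅_ : WGraph → WGraph → Set
G ≅ H = Σ (Fin (n G) ⤖ Fin (n H)) λ f →
  (∀ x y → adj H (Bijection.to f x) (Bijection.to f y) ≡ adj G x y) ×
  (∀ x → w H (Bijection.to f x) ≡ w G x)

record RTree : Set where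
  field
    tree : WGraph
    root : Fin (n tree)

open RTree public

Avoid : (G : WGraph) → Fin (n G) → Fin (n G) → Fin (n G) → Set
Avoid G v x y = Adj G x y × x ≢ v × y ≢ v

-- directed edge u → v (edges oriented away from the root):
-- u adjacent to v and u lies on every walk from the root to v
DirAdj : (R : RTree) → Fin (n (tree R)) → Fin (n (tree R)) → Set
DirAdj R u v = Adj (tree R) u v × ¬ Reach (Avoid (tree R) u) (root R) v

_≅ᵣ_ : RTree → RTree → Set
R ≅ᵣ S = Σ (Fin (n (tree R)) ⤖ Fin (n (tree S))) λ f →
  (∀ x y → DirAdj R x y ⇔ DirAdj S (Bijection.to f x) (Bijection.to f y)) ×
  (∀ x → w (tree S) (Bijection.to f x) ≡ w (tree R) x)

CanonicalR : RTree → Set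
CanonicalR R = Canonical (tree R)

IsWRTree : RTree → Set
IsWRTree R = IsWTree (tree R)

record IsTotalOrderOnIsoClasses (_≺_ : RTree → RTree → Set) : Set₁ where
  field
    respects : ∀ {R R' S S'} → R ≅ᵣ R' → S ≅ᵣ S' → R ≺ S → R' ≺ S'
    irrefl   : ∀ {R S} → R ≅ᵣ S → ¬ (R ≺ S)
    trans    : ∀ {R S U} → R ≺ S → S ≺ U → R ≺ U
    total    : ∀ R S → IsWRTree R → IsWRTree S → ¬ (R ≅ᵣ S) → (R ≺ S) ⊎ (S ≺ R)

module _ (G : WGraph) where

  private
    V = Fin (n G)

  weightOf : (V → Bool) → ℕ
  weightOf S = sum (map (w G) (filterᵇ S (allFin (n G))))

  -- s is the weight of some subtree of v (component of T - v, containing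
  -- the neighbour u of v)
  SubtreeWeight : V → ℕ → Set
  SubtreeWeight v s = Σ V λ u → Adj G v u × Σ (V → Bool) λ S →
    (∀ x → (S x ≡ true) ⇔ Reach (Avoid G v) u x) × (s ≡ weightOf S)

  -- hs(v) = h : maximum weight of a subtree of v (0 if there is none)
  HS : V → ℕ → Set
  HS v h = (∀ s → SubtreeWeight v s → s ≤ h) × ((h ≡ 0) ⊎ SubtreeWeight v h)

  Centroid : V → Set
  Centroid c = Σ ℕ λ h → HS c h × (∀ v h' → HS v h' → h ≤ h')

  -- the subgraph induced by the centroids (a path)
  CAdj : V → V → Set
  CAdj x y = Adj G x y × Centroid x × Centroid y

  EccLE : V → ℕ → Set
  EccLE c e = ∀ y → Centroid y → Σ ℕ λ k → (k ≤ e) × Walk CAdj c y k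

  CentralCentroid : V → Set
  CentralCentroid c = Centroid c × Σ ℕ λ e → EccLE c e ×
    (∀ c' e' → Centroid c' → EccLE c' e' → e ≤ e')

  CutEdge : V → V → V → V → Set
  CutEdge a b x y = Adj G x y × ¬ ((x ≡ a × y ≡ b) ⊎ (x ≡ b × y ≡ a))

  -- R is (a copy of) the rooted subtree T_a obtained by removing the edge ab,
  -- rooted at a: an adjacency- and weight-preserving embedding of R into T whose
  -- image is exactly the component of a in T - ab, sending the root to a
  RealizesSubtree : V → V → RTree → Set
  RealizesSubtree a b R = Σ (Fin (n (tree R)) → V) λ ι →
    (∀ x y → ι x ≡ ι y → x ≡ y) ×
    (∀ z → (Σ (Fin (n (tree R))) λ x → ι x ≡ z) ⇔ Reach (CutEdge a b) a z) ×
    (∀ x y → adj (tree R) x y ≡ adj G (ι x) (ι y)) ×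
    (∀ x → w (tree R) x ≡ w G (ι x)) ×
    (ι (root R) ≡ a)

  SubtreesIso : V → V → Set
  SubtreesIso a b = Σ RTree λ R → Σ RTree λ S →
    RealizesSubtree a b R × RealizesSubtree b a S × R ≅ᵣ S

  SubtreeLess : (RTree → RTree → Set) → V → V → Set
  SubtreeLess _≺_ a b = Σ RTree λ R → Σ RTree λ S →
    RealizesSubtree a b R × RealizesSubtree b a S × R ≺ S

  -- r is a legitimate root of the centroid-rooted tree (w.r.t. ≺)
  CentroidRoot : (RTree → RTree → Set) → V → Set
  CentroidRoot _≺_ r =
    (CentralCentroid r × (∀ c → CentralCentroid c → c ≡ r))
    ⊎
    (Σ V λ c' → CentralCentroid r × CentralCentroid c' × r ≢ c' ×
      (∀ c → CentralCentroid c → (c ≡ r) ⊎ (c ≡ c')) ×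
      ( SubtreesIso r c'
        ⊎ (¬ SubtreesIso r c' × SubtreeLess _≺_ r c')
        ⊎ (¬ SubtreesIso c' r × ¬ SubtreeLess _≺_ c' r)))

rootAt : (G : WGraph) → Fin (n G) → RTree
rootAt G r = record { tree = G ; root = r }

{-# OPTIONS --safe #-}
module Submission where

-- An isomorphism T ≅ T′ maps central centroids to central centroids and preserves the relations
-- "the two rooted halves at the edge c₁c₂ are isomorphic" and "≺-smaller", so it sends the chosen
-- root r to r′ unless T has two central centroids r, c and it sends r to the one not chosen in T′.
-- In that case the root rule holds for (r, c) and, pulled back along the isomorphism, also for
-- (c, r); as ≺ is a strict total order on isomorphism classes this forces the halves T_r ≅ T_c, and
-- exchanging the halves is an automorphism of T moving r to c. Conversely, a rooted isomorphism
-- preserves adjacency because every edge of a tree is directed away from the root one way or the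
-- other. Canonicity is needed only to make each half a weighted tree (with a vertex of positive
-- weight), which the totality of ≺ requires.

open import Defs
open import Data.Bool using (Bool; true; false; T; if_then_else_)
open import Data.Bool.Properties using (T-≡; ⇔→≡) renaming (_≟_ to _≟ᵇ_)
open import Data.Empty using (⊥; ⊥-elim)
open import Data.Fin using (Fin; zero; suc; _≟_)
open import Data.Fin.Properties using (any?; nonZeroIndex)
open import Data.List using (List; []; _∷_; _∷ʳ_; length; map; filterᵇ; allFin; tabulate; lookup)
open import Data.List.Properties using (filter-none; length-map; map-++; map-tabulate; map-cong)
open import Data.List.Membership.Propositional using (_∈_; _∉_)
open import Data.List.Membership.Propositional.Properties using (∈-lookup; ∈-filter⁺; ∈-filter⁻; ∈-allFin)
import Data.List.Membership.DecPropositional as DecMembership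
open import Data.List.Relation.Unary.All as All using ([])
open import Data.List.Relation.Unary.All.Properties using (¬Any⇒All¬)
open import Data.List.Relation.Unary.AllPairs using ([]; _∷_)
open import Data.List.Relation.Unary.Any using (here; there; index)
open import Data.List.Relation.Unary.Any.Properties using (lookup-index)
open import Data.List.Relation.Unary.Linked as Linked using (Linked; [-]; _∷_)
import Data.List.Relation.Unary.Linked.Properties as Linked
open import Data.List.Relation.Unary.Unique.Propositional using (Unique)
import Data.List.Relation.Unary.Unique.Propositional.Properties as Unique
open import Data.Nat using (ℕ; zero; suc; _+_; _≤_; z≤n; s≤s; >-nonZero⁻¹)
open import Data.Nat.ListAction using (sum)
open import Data.Nat.Properties using (n≢0⇒n>0; +-0-commutativeMonoid)
open import Algebra.Properties.CommutativeMonoid.Sum +-0-commutativeMonoid using (sum-permute) renaming (sum to ∑)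
open import Data.Product using (Σ; _×_; _,_; proj₁; proj₂)
import Data.Sum as Sum
open import Data.Sum using (_⊎_; inj₁; inj₂; [_,_]′)
open import Function using (_∘_; const)
open import Function.Bundles using (_⤖_; _⇔_; Bijection; Inverse; Equivalence; mk⇔; mk↔ₛ′)
open import Function.Construct.Composition using (_⤖-∘_)
open import Function.Construct.Identity using (⤖-id; ⇔-id)
open import Function.Construct.Symmetry using (⤖-sym)
open import Function.Properties.Bijection using (⤖⇒↔)
open import Function.Properties.Inverse using (↔⇒⤖)
open import Relation.Binary.Definitions using (DecidableEquality)
open import Relation.Binary.PropositionalEquality
open import Relation.Nullary using (¬_; Dec; yes; no; contradiction)
open import Relation.Nullary.Decidable using (T?; _×-dec_; _⊎-dec_; ¬?; decidable-stable)

module _ {A : Set} where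
  private
    variable
      E F : A → A → Set
      x y z v : A
      k : ℕ

  vertices : Walk E x y k → List A
  vertices (here x) = x ∷ []
  vertices (step {x} _ p) = x ∷ vertices p

  SimpleWalk : (A → A → Set) → A → A → Set
  SimpleWalk E x y = Σ ℕ λ k → Σ (Walk E x y k) λ p → Unique (vertices p)

  Avoiding : (A → A → Set) → A → A → A → Set
  Avoiding E v x y = E x y × x ≢ v × y ≢ v

  Walk-map : {B : Set} {F : B → B → Set} (f : A → B) →
    (∀ {x y} → E x y → F (f x) (f y)) → Walk E x y k → Walk F (f x) (f y) k
  Walk-map f g (here x) = here (f x)
  Walk-map f g (step e p) = step (g e) (Walk-map f g p)

  Reach-map : {B : Set} {F : B → B → Set} (f : A → B) →
    (∀ {x y} → E x y → F (f x) (f y)) → Reach E x y → Reach F (f x) (f y)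
  Reach-map f g (k , p) = k , Walk-map f g p

  Reach-mono : (∀ {x y} → E x y → F x y) → Reach E x y → Reach F x y
  Reach-mono g = Reach-map (λ x → x) g

  edge : E x y → Reach E x y
  edge e = 1 , step e (here _)

  Reach-trans : Reach E x y → Reach E y z → Reach E x z
  Reach-trans (_ , here _) q = q
  Reach-trans (_ , step e p) q with Reach-trans (_ , p) q
  ... | k , r = suc k , step e r

  Reach-sym : (∀ {x y} → E x y → E y x) → Reach E x y → Reach E y x
  Reach-sym s (_ , here x) = 0 , here x
  Reach-sym s (_ , step e p) = Reach-trans (Reach-sym s (_ , p)) (edge (s e))

  Reach-closed : {P : A → Set} → (∀ {x y} → E x y → P x → P y) → Reach E x y → P x → P y
  Reach-closed step-closed (_ , here _) px = px
  Reach-closed step-closed (_ , step e p) px = Reach-closed step-closed (_ , p) (step-closed e px)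

  first-∈ : (p : Walk E x y k) → x ∈ vertices p
  first-∈ (here _) = here refl
  first-∈ (step _ _) = here refl

  last-∈ : (p : Walk E x y k) → y ∈ vertices p
  last-∈ (here _) = here refl
  last-∈ (step _ p) = there (last-∈ p)

  last-edge : (p : Walk E x y (suc k)) → Σ _ λ u → E u y × u ∈ vertices p
  last-edge (step e (here _)) = _ , e , here refl
  last-edge (step _ p@(step _ _)) with last-edge p
  ... | u , e , u∈ = u , e , there u∈

  vertices-nonempty : (p : Walk E x y k) → 1 ≤ length (vertices p)
  vertices-nonempty (here _) = s≤s z≤n
  vertices-nonempty (step _ _) = s≤s z≤n

  vertices-linked : (∀ {x y} → E x y → F x y) → (p : Walk E x y k) → F y z →
    Linked F (vertices p ∷ʳ z)
  vertices-linked g (here _) e = e ∷ [-]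
  vertices-linked g (step e (here _)) e′ = g e ∷ e′ ∷ [-]
  vertices-linked g (step e p@(step _ _)) e′ = g e ∷ vertices-linked g p e′

  avoiding : (p : Walk E x y k) → v ∉ vertices p → Walk (Avoiding E v) x y k
  avoiding (here x) v∉ = here x
  avoiding (step e p) v∉ =
    step (e , (λ { refl → v∉ (here refl) }) , λ { refl → v∉ (there (first-∈ p)) })
         (avoiding p (λ v∈ → v∉ (there v∈)))

  suffix-from : (p : Walk E x z k) → Unique (vertices p) → y ∈ vertices p → SimpleWalk E y z
  suffix-from p@(here _) p-simple (here refl) = _ , p , p-simple
  suffix-from p@(step _ _) p-simple (here refl) = _ , p , p-simple
  suffix-from (step _ p) (_ ∷ p-simple) (there y∈) = suffix-from p p-simple y∈

  prefix-to : (p : Walk E x z k) → Unique (vertices p) → y ∈ vertices p → y ≢ z →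
    Σ ℕ λ k′ → Σ (Walk E x y k′) λ q → z ∉ vertices q
  prefix-to (here _) _ (here refl) y≢z = ⊥-elim (y≢z refl)
  prefix-to (step e p) (x∉p ∷ _) (here refl) _ =
    _ , here _ , λ { (here refl) → All.lookup x∉p (last-∈ p) refl }
  prefix-to (step e p) (x∉p ∷ p-simple) (there y∈) y≢z with prefix-to p p-simple y∈ y≢z
  ... | _ , q , z∉q = _ , step e q , λ { (here refl) → All.lookup x∉p (last-∈ p) refl
                                       ; (there z∈q) → z∉q z∈q }

  prefix-avoiding-last : (p : Walk E x z k) → Unique (vertices p) → y ∈ vertices p → y ≢ z →
    Reach (Avoiding E z) x y
  prefix-avoiding-last p p-simple y∈ y≢z with prefix-to p p-simple y∈ y≢z
  ... | _ , q , z∉q = _ , avoiding q z∉q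

  module _ (_≟ₐ_ : DecidableEquality A) where
    open DecMembership _≟ₐ_ using (_∈?_)

    shorten : Walk E x y k → SimpleWalk E x y
    shorten (here x) = _ , here x , [] ∷ []
    shorten (step {x} e p) with shorten p
    ... | _ , q , q-simple with x ∈? vertices q
    ...   | yes x∈q = suffix-from q q-simple x∈q
    ...   | no x∉q = _ , step e q , ¬Any⇒All¬ _ x∉q ∷ q-simple

lookup-injective : ∀ {A : Set} {xs : List A} → Unique xs → ∀ i j → lookup xs i ≡ lookup xs j → i ≡ j
lookup-injective (_ ∷ _) zero zero _ = refl
lookup-injective (x∉ ∷ _) zero (suc j) x≡ = ⊥-elim (All.lookup x∉ (∈-lookup j) x≡)
lookup-injective (x∉ ∷ _) (suc i) zero ≡x = ⊥-elim (All.lookup x∉ (∈-lookup i) (sym ≡x))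
lookup-injective (_ ∷ xs-unique) (suc i) (suc j) eq = cong suc (lookup-injective xs-unique i j eq)

length-filterᵇ-≡1 : ∀ {A : Set} (p : A → Bool) {xs b} → Unique xs → b ∈ xs → p b ≡ true →
  (∀ {y} → p y ≡ true → y ≡ b) → length (filterᵇ p xs) ≡ 1
length-filterᵇ-≡1 p {x ∷ xs} (x∉ ∷ xs-unique) b∈ pb only-b with p x in px
... | true = cong (suc ∘ length) (filter-none (T? ∘ p) (All.tabulate λ y∈ py →
               All.lookup x∉ y∈ (trans (only-b px) (sym (only-b (Equivalence.to T-≡ py))))))
... | false with b∈
...   | here refl = contradiction (trans (sym px) pb) λ ()
...   | there b∈xs = length-filterᵇ-≡1 p xs-unique b∈xs pb only-b

sum-filterᵇ : ∀ {A : Set} (S : A → Bool) (f : A → ℕ) (xs : List A) →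
  sum (map f (filterᵇ S xs)) ≡ sum (map (λ x → if S x then f x else 0) xs)
sum-filterᵇ S f [] = refl
sum-filterᵇ S f (x ∷ xs) with S x
... | true = cong (f x +_) (sum-filterᵇ S f xs)
... | false = sum-filterᵇ S f xs

sum-tabulate : ∀ {m} (f : Fin m → ℕ) → sum (tabulate f) ≡ ∑ f
sum-tabulate {zero} f = refl
sum-tabulate {suc m} f = cong (f zero +_) (sum-tabulate (f ∘ suc))

sum-allFin : ∀ {m} (f : Fin m → ℕ) → sum (map f (allFin m)) ≡ ∑ f
sum-allFin f = trans (cong sum (map-tabulate (λ x → x) f)) (sum-tabulate f)

sum-allFin-⤖ : ∀ {m k} (π : Fin m ⤖ Fin k) (f : Fin k → ℕ) →
  sum (map (f ∘ Bijection.to π) (allFin m)) ≡ sum (map f (allFin k))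
sum-allFin-⤖ π f = begin
  sum (map (f ∘ Bijection.to π) (allFin _)) ≡⟨ sum-allFin (f ∘ Bijection.to π) ⟩
  ∑ (f ∘ Bijection.to π)                    ≡⟨ sum-permute f (⤖⇒↔ π) ⟨
  ∑ f                                       ≡⟨ sum-allFin f ⟨
  sum (map f (allFin _))                    ∎
  where open ≡-Reasoning

record IsTree (G : WGraph) : Set where
  field
    symmetric : ∀ x y → adj G x y ≡ adj G y x
    irrefl    : ∀ x → adj G x x ≡ false
    connected : ∀ x y → Reach (Adj G) x y
    acyclic   : ¬ HasCycle G

IsWTree⇒IsTree : ∀ {G} → IsWTree G → IsTree G
IsWTree⇒IsTree G-wtree = record
  { symmetric = IsWTree.symmetric G-wtree
  ; irrefl    = IsWTree.irrefl G-wtree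
  ; connected = IsWTree.connected G-wtree
  ; acyclic   = IsWTree.acyclic G-wtree
  }

module _ {G : WGraph} where
  private
    variable
      a b r x y : Fin (n G)

  CutEdge-swap : CutEdge G a b x y → CutEdge G b a x y
  CutEdge-swap (e , not-ab) = e , λ { (inj₁ eqs) → not-ab (inj₂ eqs) ; (inj₂ eqs) → not-ab (inj₁ eqs) }

  Avoidˡ⇒CutEdge : Avoid G a x y → CutEdge G a b x y
  Avoidˡ⇒CutEdge (e , x≢a , y≢a) =
    e , λ { (inj₁ (x≡a , _)) → x≢a x≡a ; (inj₂ (_ , y≡a)) → y≢a y≡a }

  Avoidʳ⇒CutEdge : Avoid G b x y → CutEdge G a b x y
  Avoidʳ⇒CutEdge (e , x≢b , y≢b) =
    e , λ { (inj₁ (_ , y≡b)) → y≢b y≡b ; (inj₂ (x≡b , _)) → x≢b x≡b }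

  module TreeProperties (G-tree : IsTree G) where
    open IsTree G-tree

    Adj-sym : Adj G x y → Adj G y x
    Adj-sym {x} {y} e = trans (symmetric y x) e

    Adj-irrefl : Adj G x y → x ≢ y
    Adj-irrefl {x} e refl with trans (sym e) (irrefl x)
    ... | ()

    Avoid-sym : Avoid G a x y → Avoid G a y x
    Avoid-sym (e , x≢a , y≢a) = Adj-sym e , y≢a , x≢a

    CutEdge-sym : CutEdge G a b x y → CutEdge G a b y x
    CutEdge-sym (e , not-ab) = Adj-sym e ,
      λ { (inj₁ (y≡a , x≡b)) → not-ab (inj₂ (x≡b , y≡a))
        ; (inj₂ (y≡b , x≡a)) → not-ab (inj₁ (x≡a , y≡b)) }

    CutEdge-other : Adj G a b → Adj G a y → y ≢ b → CutEdge G a b a y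
    CutEdge-other ab ay y≢b =
      ay , λ { (inj₁ (_ , y≡b)) → y≢b y≡b ; (inj₂ (a≡b , _)) → Adj-irrefl ab a≡b }

    no-detour : Adj G x y → ¬ Reach (CutEdge G x y) y x
    no-detour xy y⇝x with shorten _≟_ (proj₂ y⇝x)
    ... | _ , here _ , _ = Adj-irrefl xy refl
    ... | _ , step (_ , not-xy) (here _) , _ = not-xy (inj₂ (refl , refl))
    ... | _ , p@(step _ q@(step _ q′)) , p-simple =
      acyclic (_ , vertices q , s≤s (vertices-nonempty q′) , p-simple , vertices-linked proj₁ p xy)

    no-mutual-detour : Adj G x y → Reach (Avoid G x) r y → Reach (Avoid G y) r x → ⊥
    no-mutual-detour xy r⇝y r⇝x = no-detour xy (Reach-trans
      (Reach-mono Avoidˡ⇒CutEdge (Reach-sym Avoid-sym r⇝y))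
      (Reach-mono Avoidʳ⇒CutEdge r⇝x))

module Orientation (R : RTree) (R-tree : IsTree (tree R)) where
  open IsTree R-tree
  open TreeProperties R-tree
  open DecMembership {A = Fin (n (tree R))} _≟_ using (_∈?_)

  -- If the simple walk from the root to y passes through x, its part up to x avoids y;
  -- otherwise the whole walk avoids x.
  DirAdj-either : ∀ {x y} → Adj (tree R) x y → DirAdj R x y ⊎ DirAdj R y x
  DirAdj-either {x} {y} xy with shorten _≟_ (proj₂ (connected (root R) y))
  ... | _ , p , p-simple with x ∈? vertices p
  ...   | yes x∈p = inj₁ (xy , λ r⇝y →
          no-mutual-detour xy r⇝y (prefix-avoiding-last p p-simple x∈p (Adj-irrefl xy)))
  ...   | no x∉p = inj₂ (Adj-sym xy , λ r⇝x → no-mutual-detour xy (_ , avoiding p x∉p) r⇝x)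

  parent : ∀ {v} → v ≢ root R → Σ _ λ u → DirAdj R u v
  parent {v} v≢r with shorten _≟_ (proj₂ (connected (root R) v))
  ... | _ , here _ , _ = ⊥-elim (v≢r refl)
  ... | _ , p@(step _ _) , p-simple with last-edge p
  ...   | u , uv , u∈p = u , uv , λ r⇝v →
          no-mutual-detour uv r⇝v (prefix-avoiding-last p p-simple u∈p (Adj-irrefl uv))

sole-neighbour⇒IsLeaf : ∀ {G a b} → Adj G a b → (∀ {y} → Adj G a y → y ≡ b) → IsLeaf G a
sole-neighbour⇒IsLeaf {G} {a} {b} ab b-sole = length-filterᵇ-≡1 (adj G a) (Unique.allFin⁺ _) (∈-allFin b) ab b-sole

private
  variable
    G H K : WGraph
    R S : RTree

record Iso (G H : WGraph) : Set where
  constructor iso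
  field
    bijection : Fin (n G) ⤖ Fin (n H)

  to : Fin (n G) → Fin (n H)
  to = Bijection.to bijection

  field
    adj-preserved : ∀ x y → adj H (to x) (to y) ≡ adj G x y
    w-preserved   : ∀ x → w H (to x) ≡ w G x

  from : Fin (n H) → Fin (n G)
  from = Inverse.from (⤖⇒↔ bijection)

  to∘from : ∀ y → to (from y) ≡ y
  to∘from = Inverse.strictlyInverseˡ (⤖⇒↔ bijection)

  from∘to : ∀ x → from (to x) ≡ x
  from∘to = Inverse.strictlyInverseʳ (⤖⇒↔ bijection)

  to-injective : ∀ {x y} → to x ≡ to y → x ≡ y
  to-injective = Bijection.injective bijection

  Adj-preserved : ∀ {x y} → Adj G x y → Adj H (to x) (to y)
  Adj-preserved {x} {y} e = trans (adj-preserved x y) e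

open Iso using (to; from; to∘from; from∘to; to-injective; Adj-preserved)

Iso-sym : Iso G H → Iso H G
Iso-sym {G} {H} i = iso (⤖-sym (Iso.bijection i))
  (λ x y → trans (sym (Iso.adj-preserved i (from i x) (from i y))) (cong₂ (adj H) (to∘from i x) (to∘from i y)))
  (λ x → trans (sym (Iso.w-preserved i (from i x))) (cong (w H) (to∘from i x)))

Iso-trans : Iso G H → Iso H K → Iso G K
Iso-trans i j = iso (Iso.bijection j ⤖-∘ Iso.bijection i)
  (λ x y → trans (Iso.adj-preserved j (to i x) (to i y)) (Iso.adj-preserved i x y))
  (λ x → trans (Iso.w-preserved j (to i x)) (Iso.w-preserved i x))

reflect₁ : (P : (G : WGraph) → Fin (n G) → Set) →
  (∀ {G H} (i : Iso G H) {x} → P G x → P H (to i x)) →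
  (i : Iso G H) → ∀ {x} → P H (to i x) → P G x
reflect₁ P P-preserved i {x} p = subst (P _) (from∘to i x) (P-preserved (Iso-sym i) p)

reflect₂ : (P : (G : WGraph) → Fin (n G) → Fin (n G) → Set) →
  (∀ {G H} (i : Iso G H) {x y} → P G x y → P H (to i x) (to i y)) →
  (i : Iso G H) → ∀ {x y} → P H (to i x) (to i y) → P G x y
reflect₂ P P-preserved i {x} {y} p = subst₂ (P _) (from∘to i x) (from∘to i y) (P-preserved (Iso-sym i) p)

weightOf-preserved : (i : Iso G H) (S : Fin (n G) → Bool) → weightOf H (S ∘ from i) ≡ weightOf G S
weightOf-preserved {G} {H} i S = begin
  weightOf H (S ∘ from i)                       ≡⟨ sum-filterᵇ (S ∘ from i) (w H) (allFin _) ⟩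
  sum (map restrictedᴴ (allFin _))              ≡⟨ sum-allFin-⤖ (Iso.bijection i) restrictedᴴ ⟨
  sum (map (restrictedᴴ ∘ to i) (allFin _))     ≡⟨ cong sum (map-cong restricted-preserved (allFin _)) ⟩
  sum (map restrictedᴳ (allFin _))              ≡⟨ sum-filterᵇ S (w G) (allFin _) ⟨
  weightOf G S                                  ∎
  where
  open ≡-Reasoning
  restrictedᴴ : Fin (n H) → ℕ
  restrictedᴴ y = if S (from i y) then w H y else 0
  restrictedᴳ : Fin (n G) → ℕ
  restrictedᴳ x = if S x then w G x else 0
  restricted-preserved : ∀ x → restrictedᴴ (to i x) ≡ restrictedᴳ x
  restricted-preserved x rewrite from∘to i x | Iso.w-preserved i x = refl

module _ (i : Iso G H) where

  Avoid-preserved : ∀ {v x y} → Avoid G v x y → Avoid H (to i v) (to i x) (to i y)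
  Avoid-preserved (e , x≢v , y≢v) = Adj-preserved i e , x≢v ∘ to-injective i , y≢v ∘ to-injective i

  CutEdge-preserved : ∀ {a b x y} → CutEdge G a b x y → CutEdge H (to i a) (to i b) (to i x) (to i y)
  CutEdge-preserved (e , not-ab) = Adj-preserved i e , not-ab ∘ Sum.map
    (λ (x≡a , y≡b) → to-injective i x≡a , to-injective i y≡b)
    (λ (x≡b , y≡a) → to-injective i x≡b , to-injective i y≡a)

Reach-Avoid-reflected : (i : Iso G H) → ∀ {v x y} →
  Reach (Avoid H (to i v)) (to i x) (to i y) → Reach (Avoid G v) x y
Reach-Avoid-reflected {G} i {v} {x} {y} r =
  subst (λ v → Reach (Avoid G v) x y) (from∘to i v)
    (subst₂ (Reach (Avoid G _)) (from∘to i x) (from∘to i y)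
      (Reach-map (from i) (Avoid-preserved (Iso-sym i)) r))

Reach-CutEdge-reflected : (i : Iso G H) → ∀ {a b x y} →
  Reach (CutEdge H (to i a) (to i b)) (to i x) (to i y) → Reach (CutEdge G a b) x y
Reach-CutEdge-reflected {G} i {a} {b} {x} {y} r =
  subst₂ (λ a b → Reach (CutEdge G a b) x y) (from∘to i a) (from∘to i b)
    (subst₂ (Reach (CutEdge G _ _)) (from∘to i x) (from∘to i y)
      (Reach-map (from i) (CutEdge-preserved (Iso-sym i)) r))

SubtreeWeight-preserved : (i : Iso G H) → ∀ {v s} → SubtreeWeight G v s → SubtreeWeight H (to i v) s
SubtreeWeight-preserved {G} {H} i {v} (u , vu , S , S⇔reach , s≡) =
  to i u , Adj-preserved i vu , S ∘ from i , S∘from⇔reach , trans s≡ (sym (weightOf-preserved i S))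
  where
  S∘from⇔reach : ∀ x → (S (from i x) ≡ true) ⇔ Reach (Avoid H (to i v)) (to i u) x
  S∘from⇔reach x = mk⇔
    (λ Sx → subst (Reach _ (to i u)) (to∘from i x)
              (Reach-map (to i) (Avoid-preserved i) (Equivalence.to (S⇔reach (from i x)) Sx)))
    (λ u⇝x → Equivalence.from (S⇔reach (from i x))
               (Reach-Avoid-reflected i (subst (Reach _ (to i u)) (sym (to∘from i x)) u⇝x)))

HS-preserved : (i : Iso G H) → ∀ {v h} → HS G v h → HS H (to i v) h
HS-preserved i (bounded , attained) =
  (λ s sw → bounded s (reflect₁ (λ G v → SubtreeWeight G v s) (λ j → SubtreeWeight-preserved j) i sw)) ,
  Sum.map₂ (SubtreeWeight-preserved i) attained

Centroid-preserved : (i : Iso G H) → ∀ {c} → Centroid G c → Centroid H (to i c)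
Centroid-preserved i (h , hs , minimal) =
  h , HS-preserved i hs , λ v h′ hs′ → minimal (from i v) h′ (HS-preserved (Iso-sym i) hs′)

CAdj-preserved : (i : Iso G H) → ∀ {x y} → CAdj G x y → CAdj H (to i x) (to i y)
CAdj-preserved i (e , cx , cy) = Adj-preserved i e , Centroid-preserved i cx , Centroid-preserved i cy

EccLE-preserved : (i : Iso G H) → ∀ {c e} → EccLE G c e → EccLE H (to i c) e
EccLE-preserved {H = H} i {c} ecc y cy with ecc (from i y) (Centroid-preserved (Iso-sym i) cy)
... | k , k≤e , c⇝y = k , k≤e ,
  subst (λ y → Walk (CAdj H) (to i c) y k) (to∘from i y) (Walk-map (to i) (CAdj-preserved i) c⇝y)

CentralCentroid-preserved : (i : Iso G H) → ∀ {c} → CentralCentroid G c → CentralCentroid H (to i c)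
CentralCentroid-preserved i (cc , e , ecc , minimal) =
  Centroid-preserved i cc , e , EccLE-preserved i ecc ,
  λ c′ e′ cc′ ecc′ →
    minimal (from i c′) e′ (Centroid-preserved (Iso-sym i) cc′) (EccLE-preserved (Iso-sym i) ecc′)

RealizesSubtree-preserved : (i : Iso G H) → ∀ {a b R} →
  RealizesSubtree G a b R → RealizesSubtree H (to i a) (to i b) R
RealizesSubtree-preserved {G} {H} i {a} {b} (ι , ι-injective , image , ι-adj , ι-w , ι-root) =
  to i ∘ ι , (λ x y → ι-injective x y ∘ to-injective i) , image′ ,
  (λ x y → trans (ι-adj x y) (sym (Iso.adj-preserved i (ι x) (ι y)))) ,
  (λ x → trans (ι-w x) (sym (Iso.w-preserved i (ι x)))) ,
  cong (to i) ι-root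
  where
  image′ : ∀ z → (Σ _ λ x → to i (ι x) ≡ z) ⇔ Reach (CutEdge H (to i a) (to i b)) (to i a) z
  image′ z = mk⇔
    (λ (x , ιx≡z) → subst (Reach _ (to i a)) ιx≡z
      (Reach-map (to i) (CutEdge-preserved i) (Equivalence.to (image (ι x)) (x , refl))))
    (λ a⇝z → let (x , ιx≡) = Equivalence.from (image (from i z))
                   (Reach-CutEdge-reflected i (subst (Reach _ (to i a)) (sym (to∘from i z)) a⇝z))
             in x , trans (cong (to i) ιx≡) (to∘from i z))

SubtreesIso-preserved : (i : Iso G H) → ∀ {a b} → SubtreesIso G a b → SubtreesIso H (to i a) (to i b)
SubtreesIso-preserved i (R , S , ρ , σ , R≅S) =
  R , S , RealizesSubtree-preserved i ρ , RealizesSubtree-preserved i σ , R≅S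

SubtreeLess-preserved : (i : Iso G H) → ∀ {_≺_ a b} →
  SubtreeLess G _≺_ a b → SubtreeLess H _≺_ (to i a) (to i b)
SubtreeLess-preserved i (R , S , ρ , σ , R≺S) =
  R , S , RealizesSubtree-preserved i ρ , RealizesSubtree-preserved i σ , R≺S

RootedIso : RTree → RTree → Set
RootedIso R S = Σ (Iso (tree R) (tree S)) λ i → to i (root R) ≡ root S

RootedIso-sym : RootedIso R S → RootedIso S R
RootedIso-sym {R} (i , root≡) = Iso-sym i , trans (cong (from i) (sym root≡)) (from∘to i (root R))

RootedIso-trans : ∀ {U} → RootedIso R S → RootedIso S U → RootedIso R U
RootedIso-trans (i , i-root) (j , j-root) = Iso-trans i j , trans (cong (to j) i-root) j-root

DirAdj-preserved : ((i , _) : RootedIso R S) → ∀ {x y} → DirAdj R x y → DirAdj S (to i x) (to i y)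
DirAdj-preserved {R} {S} (i , root≡) (e , ¬r⇝y) = Adj-preserved i e ,
  λ r⇝y → ¬r⇝y (Reach-Avoid-reflected i (subst (λ r → Reach _ r _) (sym root≡) r⇝y))

RootedIso⇒≅ᵣ : RootedIso R S → R ≅ᵣ S
RootedIso⇒≅ᵣ {R} {S} ρ@(i , _) = Iso.bijection i ,
  (λ x y → mk⇔ (DirAdj-preserved ρ)
                (subst₂ (DirAdj R) (from∘to i x) (from∘to i y) ∘ DirAdj-preserved (RootedIso-sym ρ))) ,
  Iso.w-preserved i

≅ᵣ-refl : ∀ R → R ≅ᵣ R
≅ᵣ-refl R = ⤖-id _ , (λ x y → ⇔-id _) , λ x → refl

≅ᵣ-sym : R ≅ᵣ S → S ≅ᵣ R
≅ᵣ-sym {R} {S} (f , f-dir , f-w) = ⤖-sym f ,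
  (λ x y → mk⇔
    (λ d → Equivalence.from (f-dir (g x) (g y)) (subst₂ (DirAdj S) (sym (f∘g x)) (sym (f∘g y)) d))
    (λ d → subst₂ (DirAdj S) (f∘g x) (f∘g y) (Equivalence.to (f-dir (g x) (g y)) d))) ,
  λ x → trans (sym (f-w (g x))) (cong (w (tree S)) (f∘g x))
  where
  g : Fin (n (tree S)) → Fin (n (tree R))
  g = Inverse.from (⤖⇒↔ f)

  f∘g : ∀ x → Bijection.to f (g x) ≡ x
  f∘g = Inverse.strictlyInverseˡ (⤖⇒↔ f)

module _ (R-tree : IsTree (tree R)) (S-tree : IsTree (tree S)) where
  private
    module R = Orientation R R-tree
    module S = Orientation S S-tree

  ≅ᵣ⇒RootedIso : R ≅ᵣ S → RootedIso R S
  ≅ᵣ⇒RootedIso (f , f-dir , f-w) = iso f adj-preserved f-w , root-preserved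
    where
    open TreeProperties

    f⁻¹ : Fin (n (tree S)) → Fin (n (tree R))
    f⁻¹ = Inverse.from (⤖⇒↔ f)

    f∘f⁻¹ : ∀ x → Bijection.to f (f⁻¹ x) ≡ x
    f∘f⁻¹ = Inverse.strictlyInverseˡ (⤖⇒↔ f)

    adj-preserved : ∀ x y → adj (tree S) (Bijection.to f x) (Bijection.to f y) ≡ adj (tree R) x y
    adj-preserved x y = ⇔→≡ (mk⇔
      ([ proj₁ ∘ Equivalence.from (f-dir x y) , Adj-sym R-tree ∘ proj₁ ∘ Equivalence.from (f-dir y x) ]′
        ∘ S.DirAdj-either)
      ([ proj₁ ∘ Equivalence.to (f-dir x y) , Adj-sym S-tree ∘ proj₁ ∘ Equivalence.to (f-dir y x) ]′
        ∘ R.DirAdj-either))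

    -- Any other vertex of S has a parent, which would pull back to a parent of the root of R.
    root-preserved : Bijection.to f (root R) ≡ root S
    root-preserved with Bijection.to f (root R) ≟ root S
    ... | yes root≡ = root≡
    ... | no root≢ with S.parent root≢
    ...   | u , u→root = ⊥-elim (proj₂ (Equivalence.from (f-dir (f⁻¹ u) (root R))
              (subst (λ u → DirAdj S u _) (sym (f∘f⁻¹ u)) u→root)) (0 , here _))

module EdgeCut {G : WGraph} (G-tree : IsTree G) {a b : Fin (n G)} (ab : Adj G a b) where
  open IsTree G-tree
  open TreeProperties G-tree

  private
    Cut : Fin (n G) → Fin (n G) → Set
    Cut = CutEdge G a b

  sides-disjoint : ∀ {z} → Reach Cut a z → Reach Cut b z → ⊥
  sides-disjoint a⇝z b⇝z =
    no-detour (Adj-sym ab) (Reach-mono (CutEdge-swap {G}) (Reach-trans a⇝z (Reach-sym CutEdge-sym b⇝z)))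

  private
    is-ab? : ∀ x y → Dec ((x ≡ a × y ≡ b) ⊎ (x ≡ b × y ≡ a))
    is-ab? x y = ((x ≟ a) ×-dec (y ≟ b)) ⊎-dec ((x ≟ b) ×-dec (y ≟ a))

  sides-cover : ∀ z → Reach Cut a z ⊎ Reach Cut b z
  sides-cover z = Reach-closed side-step (connected a z) (inj₁ (0 , here a))
    where
    side-step : ∀ {x y} → Adj G x y → Reach Cut a x ⊎ Reach Cut b x → Reach Cut a y ⊎ Reach Cut b y
    side-step {x} {y} e side with is-ab? x y
    ... | yes (inj₁ (_ , refl)) = inj₂ (0 , here b)
    ... | yes (inj₂ (_ , refl)) = inj₁ (0 , here a)
    ... | no not-ab = Sum.map (λ c⇝x → Reach-trans c⇝x (edge (e , not-ab)))
                              (λ c⇝x → Reach-trans c⇝x (edge (e , not-ab))) side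

  crossing-edge : ∀ {x y} → Adj G x y → Reach Cut a x → Reach Cut b y → x ≡ a × y ≡ b
  crossing-edge {x} {y} e a⇝x b⇝y with is-ab? x y
  ... | yes (inj₁ x≡a×y≡b) = x≡a×y≡b
  ... | yes (inj₂ (refl , refl)) = ⊥-elim (sides-disjoint a⇝x (0 , here b))
  ... | no not-ab = ⊥-elim (sides-disjoint (Reach-trans a⇝x (edge (e , not-ab))) b⇝y)

module Realization {G : WGraph} {a b : Fin (n G)} {R : RTree} (ρ : RealizesSubtree G a b R) where
  private
    Cut : Fin (n G) → Fin (n G) → Set
    Cut = CutEdge G a b

    V : Set
    V = Fin (n (tree R))

  ι : V → Fin (n G)
  ι = proj₁ ρ

  ι-injective : ∀ x y → ι x ≡ ι y → x ≡ y
  ι-injective = proj₁ (proj₂ ρ)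

  image : ∀ z → (Σ V λ x → ι x ≡ z) ⇔ Reach Cut a z
  image = proj₁ (proj₂ (proj₂ ρ))

  ι-adj : ∀ x y → adj (tree R) x y ≡ adj G (ι x) (ι y)
  ι-adj = proj₁ (proj₂ (proj₂ (proj₂ ρ)))

  ι-w : ∀ x → w (tree R) x ≡ w G (ι x)
  ι-w = proj₁ (proj₂ (proj₂ (proj₂ (proj₂ ρ))))

  ι-root : ι (root R) ≡ a
  ι-root = proj₂ (proj₂ (proj₂ (proj₂ (proj₂ ρ))))

  ι-component : ∀ x → Reach Cut a (ι x)
  ι-component x = Equivalence.to (image (ι x)) (x , refl)

  preimage : ∀ {z} → Reach Cut a z → Σ V λ x → ι x ≡ z
  preimage = Equivalence.from (image _)

  private
    Lifted : Fin (n G) → Set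
    Lifted u = Reach Cut a u × Σ V λ x → ι x ≡ u × Reach (Adj (tree R)) (root R) x

    lift-step : ∀ {u v} → Cut u v → Lifted u → Lifted v
    lift-step c (a⇝u , x , refl , r⇝x) with preimage (Reach-trans a⇝u (edge c))
    ... | y , refl = Reach-trans a⇝u (edge c) , y , refl , Reach-trans r⇝x (edge (trans (ι-adj x y) (proj₁ c)))

  reach-from-root : ∀ x → Reach (Adj (tree R)) (root R) x
  reach-from-root x with Reach-closed lift-step (ι-component x) ((0 , here a) , root R , ι-root , (0 , here _))
  ... | _ , x′ , ιx′≡ιx , r⇝x′ = subst (Reach _ (root R)) (ι-injective x′ x ιx′≡ιx) r⇝x′

  isTree : IsTree G → IsTree (tree R)
  isTree G-tree = record
    { symmetric = symmetric
    ; irrefl    = λ x → trans (ι-adj x x) (G.irrefl (ι x))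
    ; connected = λ x y → Reach-trans (Reach-sym (λ {x} {y} e → trans (symmetric y x) e) (reach-from-root x))
                                      (reach-from-root y)
    ; acyclic   = λ (x , ys , 2≤ , unique , linked) → G.acyclic (ι x , map ι ys ,
        subst (2 ≤_) (sym (length-map ι ys)) 2≤ ,
        Unique.map⁺ (ι-injective _ _) unique ,
        subst (Linked (Adj G)) (map-++ ι (x ∷ ys) (x ∷ []))
          (Linked.map⁺ (Linked.map (trans (sym (ι-adj _ _))) linked)))
    }
    where
    module G = IsTree G-tree
    symmetric : ∀ x y → adj (tree R) x y ≡ adj (tree R) y x
    symmetric x y = trans (ι-adj x y) (trans (G.symmetric (ι x) (ι y)) (sym (ι-adj y x)))

  -- If a has weight 0, then either a has a neighbour other than b, whose weight is positive since
  -- zero-weight vertices are independent, or a is a leaf and hence has positive weight after all.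
  has-positive-weight : IsTree G → Canonical G → Adj G a b → Σ V λ x → 1 ≤ w (tree R) x
  has-positive-weight G-tree (zeros-independent , leaves-positive) ab with w G a in wa≡
  ... | suc _ = root R , subst (1 ≤_) (sym (trans (ι-w (root R)) (trans (cong (w G) ι-root) wa≡))) (s≤s z≤n)
  ... | zero with any? (λ y → (adj G a y ≟ᵇ true) ×-dec ¬? (y ≟ b))
  ...   | yes (y , ay , y≢b) with preimage (edge (TreeProperties.CutEdge-other G-tree ab ay y≢b))
  ...     | x , refl = x , subst (1 ≤_) (sym (ι-w x)) (n≢0⇒n>0 (zeros-independent a (ι x) ay wa≡))
  has-positive-weight G-tree (zeros-independent , leaves-positive) ab | zero | no no-other-neighbour =
    contradiction (subst (1 ≤_) wa≡ (leaves-positive a (sole-neighbour⇒IsLeaf {G} ab b-sole))) λ ()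
    where
    b-sole : ∀ {y} → Adj G a y → y ≡ b
    b-sole {y} ay = decidable-stable (y ≟ b) λ y≢b → no-other-neighbour (y , ay , y≢b)

  isWTree : IsWTree G → Canonical G → Adj G a b → IsWTree (tree R)
  isWTree G-wtree G-canonical ab = record
    { nonempty  = >-nonZero⁻¹ _ {{nonZeroIndex (root R)}}
    ; symmetric = R-tree.symmetric
    ; irrefl    = R-tree.irrefl
    ; connected = R-tree.connected
    ; acyclic   = R-tree.acyclic
    ; positive  = has-positive-weight (IsWTree⇒IsTree G-wtree) G-canonical ab
    }
    where module R-tree = IsTree (isTree (IsWTree⇒IsTree G-wtree))

module _ {G : WGraph} {a b : Fin (n G)} where

  realizations-RootedIso : ∀ {R₁ R₂} →
    RealizesSubtree G a b R₁ → RealizesSubtree G a b R₂ → RootedIso R₁ R₂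
  realizations-RootedIso {R₁} {R₂} ρ₁ ρ₂ =
    iso (↔⇒⤖ (mk↔ₛ′ φ ψ φ∘ψ ψ∘φ))
        (λ x y → trans (ρ₂.ι-adj (φ x) (φ y))
                   (trans (cong₂ (adj G) (ι₂∘φ x) (ι₂∘φ y)) (sym (ρ₁.ι-adj x y))))
        (λ x → trans (ρ₂.ι-w (φ x)) (trans (cong (w G) (ι₂∘φ x)) (sym (ρ₁.ι-w x)))) ,
    ρ₂.ι-injective _ _ (trans (ι₂∘φ (root R₁)) (trans ρ₁.ι-root (sym ρ₂.ι-root)))
    where
    module ρ₁ = Realization {G} ρ₁
    module ρ₂ = Realization {G} ρ₂

    φ : Fin (n (tree R₁)) → Fin (n (tree R₂))
    φ x = proj₁ (ρ₂.preimage (ρ₁.ι-component x))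

    ι₂∘φ : ∀ x → ρ₂.ι (φ x) ≡ ρ₁.ι x
    ι₂∘φ x = proj₂ (ρ₂.preimage (ρ₁.ι-component x))

    ψ : Fin (n (tree R₂)) → Fin (n (tree R₁))
    ψ y = proj₁ (ρ₁.preimage (ρ₂.ι-component y))

    ι₁∘ψ : ∀ y → ρ₁.ι (ψ y) ≡ ρ₂.ι y
    ι₁∘ψ y = proj₂ (ρ₁.preimage (ρ₂.ι-component y))

    φ∘ψ : ∀ y → φ (ψ y) ≡ y
    φ∘ψ y = ρ₂.ι-injective _ _ (trans (ι₂∘φ (ψ y)) (ι₁∘ψ y))

    ψ∘φ : ∀ x → ψ (φ x) ≡ x
    ψ∘φ x = ρ₁.ι-injective _ _ (trans (ι₁∘ψ (φ x)) (ι₂∘φ x))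

  rootAt-realizes : IsTree G → ¬ Adj G a b → RealizesSubtree G a b (rootAt G a)
  rootAt-realizes G-tree ¬ab = (λ x → x) , (λ _ _ eq → eq) ,
    (λ z → mk⇔ (λ { (x , refl) → Reach-mono uncut (IsTree.connected G-tree a x) }) (λ _ → z , refl)) ,
    (λ _ _ → refl) , (λ _ → refl) , refl
    where
    uncut : ∀ {x y} → Adj G x y → CutEdge G a b x y
    uncut e = e , λ { (inj₁ (refl , refl)) → ¬ab e
                    ; (inj₂ (refl , refl)) → ¬ab (TreeProperties.Adj-sym G-tree e) }

  module Component (G-tree : IsTree G) (ab : Adj G a b) where
    open EdgeCut G-tree ab

    in-component : Fin (n G) → Bool
    in-component z = [ const true , const false ]′ (sides-cover z)

    in-component-sound : ∀ z → T (in-component z) → Reach (CutEdge G a b) a z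
    in-component-sound z _ with sides-cover z
    ... | inj₁ a⇝z = a⇝z

    in-component-complete : ∀ {z} → Reach (CutEdge G a b) a z → T (in-component z)
    in-component-complete {z} a⇝z with sides-cover z
    ... | inj₁ _ = _
    ... | inj₂ b⇝z = sides-disjoint a⇝z b⇝z

    private
      vertices-in : List (Fin (n G))
      vertices-in = filterᵇ in-component (allFin _)

      listed : ∀ {z} → Reach (CutEdge G a b) a z → z ∈ vertices-in
      listed {z} a⇝z = ∈-filter⁺ (T? ∘ in-component) (∈-allFin z) (in-component-complete a⇝z)

    component : RTree
    component = record
      { tree = record
        { n   = length vertices-in
        ; adj = λ i j → adj G (lookup vertices-in i) (lookup vertices-in j)
        ; w   = λ i → w G (lookup vertices-in i)
        }
      ; root = index (listed (0 , here a))
      }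

    component-realizes : RealizesSubtree G a b component
    component-realizes = lookup vertices-in ,
      lookup-injective (Unique.filter⁺ (T? ∘ in-component) (Unique.allFin⁺ _)) ,
      (λ z → mk⇔ (λ { (i , refl) → in-component-sound _
                                      (proj₂ (∈-filter⁻ (T? ∘ in-component) {xs = allFin _} (∈-lookup i))) })
                 (λ a⇝z → index (listed a⇝z) , sym (lookup-index (listed a⇝z)))) ,
      (λ _ _ → refl) , (λ _ → refl) , sym (lookup-index (listed (0 , here a)))

ι-adj-transfer : ∀ {G a b c d R₁ R₂} (ρ₁ : RealizesSubtree G a b R₁) (ρ₂ : RealizesSubtree G c d R₂)
  (j : Iso (tree R₁) (tree R₂)) → ∀ x y →
  adj G (Realization.ι {G} ρ₂ (to j x)) (Realization.ι {G} ρ₂ (to j y)) ≡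
  adj G (Realization.ι {G} ρ₁ x) (Realization.ι {G} ρ₁ y)
ι-adj-transfer {G} {R₁ = R₁} {R₂} ρ₁ ρ₂ j x y = begin
  adj G (ρ₂.ι (to j x)) (ρ₂.ι (to j y)) ≡⟨ ρ₂.ι-adj (to j x) (to j y) ⟨
  adj (tree R₂) (to j x) (to j y)       ≡⟨ Iso.adj-preserved j x y ⟩
  adj (tree R₁) x y                     ≡⟨ ρ₁.ι-adj x y ⟩
  adj G (ρ₁.ι x) (ρ₁.ι y)               ∎
  where
  open ≡-Reasoning
  module ρ₁ = Realization {G} ρ₁
  module ρ₂ = Realization {G} ρ₂

module Swap {G : WGraph} (G-tree : IsTree G) {a b : Fin (n G)} (ab : Adj G a b)
            {R S : RTree} (ρ : RealizesSubtree G a b R) (σ : RealizesSubtree G b a S)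
            (R≃S : RootedIso R S) where
  open IsTree G-tree
  open TreeProperties G-tree
  open EdgeCut G-tree ab
  private
    module ρ = Realization {G} ρ
    module σ = Realization {G} σ

    Cut : Fin (n G) → Fin (n G) → Set
    Cut = CutEdge G a b

    h : Iso (tree R) (tree S)
    h = proj₁ R≃S

    σ-component : ∀ y → Reach Cut b (σ.ι y)
    σ-component y = Reach-mono (CutEdge-swap {G}) (σ.ι-component y)

    σ-preimage : ∀ {z} → Reach Cut b z → Σ _ λ y → σ.ι y ≡ z
    σ-preimage b⇝z = σ.preimage (Reach-mono (CutEdge-swap {G}) b⇝z)

    image-cover : ∀ z → (Σ _ λ x → ρ.ι x ≡ z) ⊎ (Σ _ λ y → σ.ι y ≡ z)
    image-cover z = Sum.map ρ.preimage σ-preimage (sides-cover z)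

    swap-on : ∀ z → Reach Cut a z ⊎ Reach Cut b z → Fin (n G)
    swap-on z (inj₁ a⇝z) = σ.ι (to h (proj₁ (ρ.preimage a⇝z)))
    swap-on z (inj₂ b⇝z) = ρ.ι (from h (proj₁ (σ-preimage b⇝z)))

  swap : Fin (n G) → Fin (n G)
  swap z = swap-on z (sides-cover z)

  swap-ρ : ∀ x → swap (ρ.ι x) ≡ σ.ι (to h x)
  swap-ρ x with sides-cover (ρ.ι x)
  ... | inj₁ a⇝ιx = cong (σ.ι ∘ to h) (ρ.ι-injective _ _ (proj₂ (ρ.preimage a⇝ιx)))
  ... | inj₂ b⇝ιx = ⊥-elim (sides-disjoint (ρ.ι-component x) b⇝ιx)

  swap-σ : ∀ y → swap (σ.ι y) ≡ ρ.ι (from h y)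
  swap-σ y with sides-cover (σ.ι y)
  ... | inj₁ a⇝ιy = ⊥-elim (sides-disjoint a⇝ιy (σ-component y))
  ... | inj₂ b⇝ιy = cong (ρ.ι ∘ from h) (σ.ι-injective _ _ (proj₂ (σ-preimage b⇝ιy)))

  swap-involutive : ∀ z → swap (swap z) ≡ z
  swap-involutive z with image-cover z
  ... | inj₁ (x , refl) = trans (cong swap (swap-ρ x)) (trans (swap-σ (to h x)) (cong ρ.ι (from∘to h x)))
  ... | inj₂ (y , refl) = trans (cong swap (swap-σ y)) (trans (swap-ρ (from h y)) (cong σ.ι (to∘from h y)))

  swap-w : ∀ z → w G (swap z) ≡ w G z
  swap-w z with image-cover z
  ... | inj₁ (x , refl) = begin
    w G (swap (ρ.ι x))   ≡⟨ cong (w G) (swap-ρ x) ⟩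
    w G (σ.ι (to h x))   ≡⟨ σ.ι-w (to h x) ⟨
    w (tree S) (to h x)  ≡⟨ Iso.w-preserved h x ⟩
    w (tree R) x         ≡⟨ ρ.ι-w x ⟩
    w G (ρ.ι x)          ∎
    where open ≡-Reasoning
  ... | inj₂ (y , refl) = begin
    w G (swap (σ.ι y))   ≡⟨ cong (w G) (swap-σ y) ⟩
    w G (ρ.ι (from h y)) ≡⟨ ρ.ι-w (from h y) ⟨
    w (tree R) (from h y) ≡⟨ Iso.w-preserved (Iso-sym h) y ⟩
    w (tree S) y         ≡⟨ σ.ι-w y ⟩
    w G (σ.ι y)          ∎
    where open ≡-Reasoning

  swap-a : swap a ≡ b
  swap-a = begin
    swap a                  ≡⟨ cong swap ρ.ι-root ⟨
    swap (ρ.ι (root R))     ≡⟨ swap-ρ (root R) ⟩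
    σ.ι (to h (root R))     ≡⟨ cong σ.ι (proj₂ R≃S) ⟩
    σ.ι (root S)            ≡⟨ σ.ι-root ⟩
    b                       ∎
    where open ≡-Reasoning

  swap-b : swap b ≡ a
  swap-b = trans (cong swap (sym swap-a)) (swap-involutive a)

  swap-a-side : ∀ {z} → Reach Cut a z → Reach Cut b (swap z)
  swap-a-side a⇝z with ρ.preimage a⇝z
  ... | x , refl = subst (Reach Cut b) (sym (swap-ρ x)) (σ-component (to h x))

  swap-b-side : ∀ {z} → Reach Cut b z → Reach Cut a (swap z)
  swap-b-side b⇝z with σ-preimage b⇝z
  ... | y , refl = subst (Reach Cut a) (sym (swap-σ y)) (ρ.ι-component (from h y))

  swap-adj-across : ∀ {x y} → Reach Cut a x → Reach Cut b y → adj G (swap x) (swap y) ≡ adj G x y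
  swap-adj-across {x} {y} a⇝x b⇝y = ⇔→≡ (mk⇔
    (λ e → let (sy≡a , sx≡b) = crossing-edge (Adj-sym e) (swap-b-side b⇝y) (swap-a-side a⇝x)
           in subst₂ (Adj G) (sym (unswap sx≡b swap-b)) (sym (unswap sy≡a swap-a)) ab)
    (λ e → let (x≡a , y≡b) = crossing-edge e a⇝x b⇝y
           in subst₂ (Adj G) (sym (trans (cong swap x≡a) swap-a)) (sym (trans (cong swap y≡b) swap-b)) (Adj-sym ab)))
    where
    unswap : ∀ {u v t} → swap u ≡ v → swap v ≡ t → u ≡ t
    unswap {u} su≡v sv≡t = trans (sym (swap-involutive u)) (trans (cong swap su≡v) sv≡t)

  swap-adj : ∀ x y → adj G (swap x) (swap y) ≡ adj G x y
  swap-adj x y with image-cover x | image-cover y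
  ... | inj₁ (x′ , refl) | inj₁ (y′ , refl) =
    trans (cong₂ (adj G) (swap-ρ x′) (swap-ρ y′)) (ι-adj-transfer {G} ρ σ h x′ y′)
  ... | inj₂ (x′ , refl) | inj₂ (y′ , refl) =
    trans (cong₂ (adj G) (swap-σ x′) (swap-σ y′)) (ι-adj-transfer {G} σ ρ (Iso-sym h) x′ y′)
  ... | inj₁ (x′ , refl) | inj₂ (y′ , refl) = swap-adj-across (ρ.ι-component x′) (σ-component y′)
  ... | inj₂ (x′ , refl) | inj₁ (y′ , refl) =
    trans (symmetric _ _) (trans (swap-adj-across (ρ.ι-component y′) (σ-component x′)) (symmetric _ _))

  automorphism : Iso G G
  automorphism = iso (↔⇒⤖ (mk↔ₛ′ swap swap swap-involutive swap-involutive)) swap-adj swap-w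

SubtreesIso⇒automorphism : ∀ {G a b} → IsTree G → SubtreesIso G a b → Σ (Iso G G) λ σ → to σ a ≡ b
SubtreesIso⇒automorphism {G} {a} {b} G-tree (R , S , ρ , σ , R≅S) = by-adjacency (adj G a b ≟ᵇ true)
  where
  h : RootedIso R S
  h = ≅ᵣ⇒RootedIso (Realization.isTree {G} ρ G-tree) (Realization.isTree {G} σ G-tree) R≅S

  by-adjacency : Dec (Adj G a b) → Σ (Iso G G) λ σ → to σ a ≡ b
  by-adjacency (yes ab) = Swap.automorphism G-tree ab ρ σ h , Swap.swap-a G-tree ab ρ σ h
  -- Cutting a non-edge removes nothing, so R and S are copies of G rooted at a and at b.
  by-adjacency (no ¬ab) =
    RootedIso-trans (realizations-RootedIso {G} (rootAt-realizes G-tree ¬ab) ρ)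
      (RootedIso-trans h (realizations-RootedIso {G} σ (rootAt-realizes G-tree (¬ab ∘ TreeProperties.Adj-sym G-tree))))

SubtreesIso-sym : ∀ {a b} → SubtreesIso G a b → SubtreesIso G b a
SubtreesIso-sym (R , S , ρ , σ , R≅S) = S , R , σ , ρ , ≅ᵣ-sym R≅S

realization-exists : IsWTree G → Canonical G → ∀ a b → Σ RTree λ R → RealizesSubtree G a b R × IsWRTree R
realization-exists {G} G-wtree G-canonical a b with adj G a b ≟ᵇ true
... | yes ab = component , component-realizes ,
               Realization.isWTree {G} component-realizes G-wtree G-canonical ab
  where open Component (IsWTree⇒IsTree G-wtree) ab
... | no ¬ab = rootAt G a , rootAt-realizes (IsWTree⇒IsTree G-wtree) ¬ab , G-wtree

-- The root rule of CentroidRoot: r may be chosen over the other central centroid c.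
Preferred : (G : WGraph) → (RTree → RTree → Set) → Fin (n G) → Fin (n G) → Set
Preferred G _≺_ r c =
  SubtreesIso G r c ⊎ (¬ SubtreesIso G r c × SubtreeLess G _≺_ r c) ⊎
  (¬ SubtreesIso G c r × ¬ SubtreeLess G _≺_ c r)

Preferred-reflected : ∀ {_≺_} (i : Iso G H) → ∀ {a b} →
  Preferred H _≺_ (to i a) (to i b) → Preferred G _≺_ a b
Preferred-reflected {_≺_ = _≺_} i = Sum.map (reflect₂ SubtreesIso (λ j → SubtreesIso-preserved j) i) (Sum.map
  (λ (¬iso , less) → ¬iso ∘ SubtreesIso-preserved i ,
                     reflect₂ (λ G → SubtreeLess G _≺_) (λ j → SubtreeLess-preserved j) i less)
  (λ (¬iso , ¬less) → ¬iso ∘ SubtreesIso-preserved i , ¬less ∘ SubtreeLess-preserved i))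

module _ {_≺_ : RTree → RTree → Set} (≺-order : IsTotalOrderOnIsoClasses _≺_) where
  private
    module ≺ = IsTotalOrderOnIsoClasses ≺-order

  SubtreeLess-asym : ∀ {a b} → SubtreeLess G _≺_ a b → ¬ SubtreeLess G _≺_ b a
  SubtreeLess-asym {G} (R , S , ρ , σ , R≺S) (S′ , R′ , σ′ , ρ′ , S′≺R′) =
    ≺.irrefl (≅ᵣ-refl R′) (≺.trans R′≺S′ S′≺R′)
    where
    R′≺S′ : R′ ≺ S′
    R′≺S′ = ≺.respects (RootedIso⇒≅ᵣ (realizations-RootedIso {G} ρ ρ′))
                       (RootedIso⇒≅ᵣ (realizations-RootedIso {G} σ σ′)) R≺S

  SubtreeLess-total : IsWTree G → Canonical G → ∀ {a b} →
    ¬ SubtreesIso G a b → SubtreeLess G _≺_ a b ⊎ SubtreeLess G _≺_ b a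
  SubtreeLess-total G-wtree G-canonical {a} {b} ¬iso
    with realization-exists G-wtree G-canonical a b | realization-exists G-wtree G-canonical b a
  ... | R , ρ , R-wtree | S , σ , S-wtree =
    Sum.map (λ R≺S → R , S , ρ , σ , R≺S) (λ S≺R → S , R , σ , ρ , S≺R)
            (≺.total R S R-wtree S-wtree (λ R≅S → ¬iso (R , S , ρ , σ , R≅S)))

  Preferred-both⇒SubtreesIso : IsWTree G → Canonical G → ∀ {r c} →
    Preferred G _≺_ r c → Preferred G _≺_ c r → SubtreesIso G r c
  Preferred-both⇒SubtreesIso _ _ (inj₁ r≅c) _ = r≅c
  Preferred-both⇒SubtreesIso {G} _ _ _ (inj₁ c≅r) = SubtreesIso-sym {G} c≅r
  Preferred-both⇒SubtreesIso {G} _ _ (inj₂ (inj₁ (_ , less))) (inj₂ (inj₁ (_ , less′))) =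
    ⊥-elim (SubtreeLess-asym {G} less less′)
  Preferred-both⇒SubtreesIso _ _ (inj₂ (inj₁ (_ , less))) (inj₂ (inj₂ (_ , ¬less))) = ⊥-elim (¬less less)
  Preferred-both⇒SubtreesIso _ _ (inj₂ (inj₂ (_ , ¬less))) (inj₂ (inj₁ (_ , less))) = ⊥-elim (¬less less)
  Preferred-both⇒SubtreesIso G-wtree G-canonical (inj₂ (inj₂ (_ , ¬less))) (inj₂ (inj₂ (¬iso , ¬less′))) =
    ⊥-elim (Sum.[ ¬less′ , ¬less ] (SubtreeLess-total G-wtree G-canonical ¬iso))

  centroid-roots-match : ∀ {T T′} → IsWTree T → Canonical T → Iso T T′ → ∀ {r r′} →
    CentroidRoot T _≺_ r → CentroidRoot T′ _≺_ r′ → Σ (Iso T T′) λ g → to g r ≡ r′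
  centroid-roots-match _ _ i (inj₁ (r-central , _)) (inj₁ (_ , only-r′)) =
    i , only-r′ _ (CentralCentroid-preserved i r-central)
  centroid-roots-match _ _ i (inj₁ (_ , only-r)) (inj₂ (d , r′-central , d-central , r′≢d , _)) =
    ⊥-elim (r′≢d (to-injective (Iso-sym i)
      (trans (only-r _ (CentralCentroid-preserved (Iso-sym i) r′-central))
             (sym (only-r _ (CentralCentroid-preserved (Iso-sym i) d-central))))))
  centroid-roots-match _ _ i (inj₂ (c , r-central , c-central , r≢c , _)) (inj₁ (_ , only-r′)) =
    ⊥-elim (r≢c (to-injective i
      (trans (only-r′ _ (CentralCentroid-preserved i r-central))
             (sym (only-r′ _ (CentralCentroid-preserved i c-central))))))
  centroid-roots-match {T} {T′} T-wtree T-canonical i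
    (inj₂ (c , r-central , c-central , r≢c , _ , r-preferred))
    (inj₂ (d , _ , _ , _ , r′-or-d , r′-preferred))
    with r′-or-d _ (CentralCentroid-preserved i r-central) | r′-or-d _ (CentralCentroid-preserved i c-central)
  ... | inj₁ ir≡r′ | _ = i , ir≡r′
  ... | inj₂ ir≡d | inj₂ ic≡d = ⊥-elim (r≢c (to-injective i (trans ir≡d (sym ic≡d))))
  ... | inj₂ ir≡d | inj₁ ic≡r′
    with SubtreesIso⇒automorphism (IsWTree⇒IsTree T-wtree)
           (Preferred-both⇒SubtreesIso T-wtree T-canonical r-preferred
             (Preferred-reflected i (subst₂ (Preferred T′ _≺_) (sym ic≡r′) (sym ir≡d) r′-preferred)))
  ...   | σ , σr≡c = Iso-trans σ i , trans (cong (to i) σr≡c) ic≡r′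

corollary3 : (_≺_ : RTree → RTree → Set) → IsTotalOrderOnIsoClasses _≺_ →
    (T T' : WGraph) → IsWTree T → IsWTree T' → Canonical T → Canonical T' →
    (r : Fin (n T)) (r' : Fin (n T')) →
    CentroidRoot T _≺_ r → CentroidRoot T' _≺_ r' →
    (T ≅ T') ⇔ ((rootAt T r ≅ᵣ rootAt T' r') ×
                CanonicalR (rootAt T r) × CanonicalR (rootAt T' r'))
corollary3 _≺_ ≺-order T T′ T-wtree T′-wtree T-canonical T′-canonical r r′ r-root r′-root = mk⇔
  (λ (f , f-adj , f-w) →
    RootedIso⇒≅ᵣ (centroid-roots-match ≺-order T-wtree T-canonical (iso f f-adj f-w) r-root r′-root) ,
    T-canonical , T′-canonical)
  (λ (T≅ᵣT′ , _) →
    let (g , _) = ≅ᵣ⇒RootedIso (IsWTree⇒IsTree T-wtree) (IsWTree⇒IsTree T′-wtree) T≅ᵣT′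
    in Iso.bijection g , Iso.adj-preserved g , Iso.w-preserved g)
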